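{- Let $X$ be a $(95,40,12,20)$ strongly regular graph and let $K$ be a $4$-clique of $X$ that is not contained in any $5$-clique of $X$. For $i\in\{0,1,2,3\}$ let $X_i$ be the set of vertices of $V(X)\setminus V(K)$ having exactly $i$ neighbours in $K$, and suppose $(|X_0|,|X_1|,|X_2|,|X_3|)=(3,28,60,0)$. Then every vertex of $X_2$ has exactly two neighbours in $X_0$.
   Context: A $k$-regular graph $G$ on $v$ vertices is a $(v,k,\lambda,\mu)$ strongly regular graph if any two distinct adjacent vertices have exactly $\lambda$ common neighbours and any two distinct non-adjacent vertices have exactly $\mu$ common neighbours. -}

module Defs where

open import Data.Nat using (ℕ)
open import Data.Bool using (Bool; true; false; T)
open import Data.Fin using (Fin)
open import Data.List using (List; length; filterᵇ; allFin)
open import Data.Bool.ListAction using (any)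
open import Relation.Nullary.Decidable using (⌊_⌋)
import Data.Fin
open import Data.List.Membership.Propositional using (_∈_)
open import Data.List.Relation.Unary.Unique.Propositional using (Unique)
open import Data.Product using (_×_; ∃)
open import Relation.Nullary using (¬_)
open import Relation.Binary.PropositionalEquality using (_≡_)

record Graph (n : ℕ) : Set where
  field
    adj       : Fin n → Fin n → Bool
    adj-sym   : ∀ x y → adj x y ≡ adj y x
    adj-irrefl : ∀ x → adj x x ≡ false

open Graph public

V : (n : ℕ) → List (Fin n)
V n = allFin n

commonNbrs : ∀ {n} → Graph n → Fin n → Fin n → ℕ
commonNbrs {n} G x y = length (filterᵇ (λ z → adj G x z Data.Bool.∧ adj G y z) (V n))

degree : ∀ {n} → Graph n → Fin n → ℕ
degree {n} G x = length (filterᵇ (adj G x) (V n))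

record IsSRG (v k l m : ℕ) (G : Graph v) : Set where
  field
    regular  : ∀ x → degree G x ≡ k
    lambda   : ∀ x y → ¬ x ≡ y → T (adj G x y) → commonNbrs G x y ≡ l
    mu       : ∀ x y → ¬ x ≡ y → ¬ T (adj G x y) → commonNbrs G x y ≡ m

IsClique : ∀ {n} → Graph n → List (Fin n) → Set
IsClique G C = Unique C × (∀ x y → x ∈ C → y ∈ C → ¬ x ≡ y → T (adj G x y))

IsKClique : ∀ {n} → Graph n → ℕ → List (Fin n) → Set
IsKClique G s C = IsClique G C × length C ≡ s

_⊆V_ : ∀ {n} → List (Fin n) → List (Fin n) → Set
K ⊆V L = ∀ x → x ∈ K → x ∈ L

nbrsIn : ∀ {n} → Graph n → List (Fin n) → Fin n → ℕ
nbrsIn G K x = length (filterᵇ (adj G x) K)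

inListᵇ : ∀ {n} → Fin n → List (Fin n) → Bool
inListᵇ x K = any (λ y → ⌊ x Data.Fin.≟ y ⌋) K

Xi : ∀ {n} → Graph n → List (Fin n) → ℕ → List (Fin n)
Xi {n} G K i = filterᵇ (λ x → Data.Bool.not (inListᵇ x K) Data.Bool.∧ (nbrsIn G K x Data.Nat.≡ᵇ i)) (V n)

-- For a ∈ X₀, counting the paths a ∼ z ∼ k with
-- k ∈ K gives 4μ = 80; every neighbour z of a lies outside K and has at most two
-- neighbours in K (three is excluded by X₃ = ∅, four by maximality of K), while a
-- has degree 40, so every neighbour of a lies in X₂.  Two vertices of X₀ are
-- non-adjacent, so their neighbourhoods cover 40 + 40 − 20 = 60 = |X₂| vertices of
-- X₂, i.e. all of X₂.  Hence each vertex of X₂ sees at least two of the three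
-- vertices of X₀, and since the edges between X₀ and X₂ number 3 · 40 = 2 · 60,
-- it sees exactly two.

module Submission where

open import Defs
open import Algebra.Properties.CommutativeSemigroup using (interchange)
open import Data.Bool using (Bool; true; false; T; not; _∧_; _∨_)
open import Data.Bool.Properties using (T-∧; T-∨)
open import Data.Empty using (⊥-elim)
open import Data.Fin using (Fin)
open import Data.List using (List; []; _∷_; length; map; filterᵇ)
open import Data.List.Membership.Propositional using (_∈_; _∉_)
open import Data.List.Membership.Propositional.Properties using (∈-filter⁺; ∈-filter⁻; ∈-allFin)
open import Data.List.Properties using (map-cong; length-filter; filter-complete)
import Data.List.Relation.Unary.All as All
import Data.List.Relation.Unary.Any as Any
open import Data.List.Relation.Unary.Any using (here; there)
open import Data.List.Relation.Unary.Any.Properties using (any⁺; any⁻)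
open import Data.List.Relation.Unary.Unique.Propositional using (Unique; []; _∷_)
open import Data.List.Relation.Unary.Unique.Propositional.Properties using (allFin⁺; filter⁺)
open import Data.Nat using (ℕ; suc; _+_; _*_; _≤_; z≤n; s≤s; s≤s⁻¹; _≡ᵇ_)
open import Data.Nat.ListAction using (sum)
open import Data.Nat.Properties
  using ( +-commutativeSemigroup; +-mono-≤; +-monoˡ-≤; +-monoʳ-≤; +-cancelˡ-≡; +-cancelʳ-≡
        ; +-cancelʳ-≤; *-zeroʳ; *-identityˡ; *-distribˡ-+; *-distribʳ-+
        ; ≤-refl; ≤-reflexive; ≤-trans; ≤-antisym; ≤∧≢⇒<; 1+n≢0; ≡⇒≡ᵇ; ≡ᵇ⇒≡ )
open import Data.Product using (_×_; Σ; _,_; proj₁; proj₂)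
open import Data.Sum using ([_,_])
open import Function using (_∘_)
open import Function.Bundles using (Equivalence)
open import Relation.Binary.PropositionalEquality using (_≡_; _≗_; refl; sym; trans; cong; cong₂; subst; module ≡-Reasoning)
open import Relation.Nullary using (¬_)
open import Relation.Nullary.Decidable using (T?; toWitness; fromWitness)

private variable
  A B : Set
  n : ℕ

∑ : List A → (A → ℕ) → ℕ
∑ xs f = sum (map f xs)

syntax ∑ xs (λ x → e) = ∑[ x ∈ xs ] e

∑-cong : ∀ {f g : A → ℕ} → f ≗ g → ∀ xs → ∑ xs f ≡ ∑ xs g
∑-cong f≗g xs = cong sum (map-cong f≗g xs)

∑-const : ∀ {f : A → ℕ} {c} xs → (∀ {x} → x ∈ xs → f x ≡ c) → ∑ xs f ≡ length xs * c
∑-const []       _     = refl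
∑-const (x ∷ xs) fx≡c = cong₂ _+_ (fx≡c (here refl)) (∑-const xs (fx≡c ∘ there))

∑-+ : ∀ (f g : A → ℕ) xs → ∑[ x ∈ xs ] (f x + g x) ≡ ∑ xs f + ∑ xs g
∑-+ f g []       = refl
∑-+ f g (x ∷ xs) = trans (cong (f x + g x +_) (∑-+ f g xs))
                         (interchange +-commutativeSemigroup (f x) (g x) _ _)

∑-*ˡ : ∀ c (f : A → ℕ) xs → ∑[ x ∈ xs ] (c * f x) ≡ c * ∑ xs f
∑-*ˡ c f []       = sym (*-zeroʳ c)
∑-*ˡ c f (x ∷ xs) = trans (cong (c * f x +_) (∑-*ˡ c f xs)) (sym (*-distribˡ-+ c (f x) _))

∑-*ʳ : ∀ c (f : A → ℕ) xs → ∑[ x ∈ xs ] (f x * c) ≡ ∑ xs f * c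
∑-*ʳ c f []       = refl
∑-*ʳ c f (x ∷ xs) = trans (cong (f x * c +_) (∑-*ʳ c f xs)) (sym (*-distribʳ-+ c (f x) _))

∑-swap : ∀ (f : A → B → ℕ) xs ys → ∑[ x ∈ xs ] ∑ ys (f x) ≡ ∑[ y ∈ ys ] ∑[ x ∈ xs ] f x y
∑-swap f []       ys = sym (trans (∑-const ys (λ _ → refl)) (*-zeroʳ (length ys)))
∑-swap f (x ∷ xs) ys = begin
  ∑ ys (f x) + ∑[ x′ ∈ xs ] ∑ ys (f x′)        ≡⟨ cong (∑ ys (f x) +_) (∑-swap f xs ys) ⟩
  ∑ ys (f x) + ∑[ y ∈ ys ] ∑[ x′ ∈ xs ] f x′ y  ≡⟨ ∑-+ (f x) _ ys ⟨
  ∑[ y ∈ ys ] (f x y + ∑[ x′ ∈ xs ] f x′ y)     ∎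
  where open ≡-Reasoning

∑-mono-≤ : ∀ {f g : A → ℕ} → (∀ x → f x ≤ g x) → ∀ xs → ∑ xs f ≤ ∑ xs g
∑-mono-≤ f≤g []       = z≤n
∑-mono-≤ f≤g (x ∷ xs) = +-mono-≤ (f≤g x) (∑-mono-≤ f≤g xs)

+-mono-≤-tight : ∀ {a b c d} → a ≤ b → c ≤ d → a + c ≡ b + d → a ≡ b × c ≡ d
+-mono-≤-tight {a} {b} {c} {d} a≤b c≤d eq =
  a≡b , +-cancelˡ-≡ b c d (trans (cong (_+ c) (sym a≡b)) eq)
  where
  a≡b : a ≡ b
  a≡b = ≤-antisym a≤b (+-cancelʳ-≤ c b a (≤-trans (+-monoʳ-≤ b c≤d) (≤-reflexive (sym eq))))

∑-mono-≤-tight : ∀ {f g : A → ℕ} → (∀ x → f x ≤ g x) →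
                 ∀ {xs} → ∑ xs f ≡ ∑ xs g → ∀ {x} → x ∈ xs → f x ≡ g x
∑-mono-≤-tight f≤g {y ∷ ys} eq x∈xs with +-mono-≤-tight (f≤g y) (∑-mono-≤ f≤g ys) eq
∑-mono-≤-tight f≤g {y ∷ ys} eq (here refl)  | fy≡gy , _    = fy≡gy
∑-mono-≤-tight f≤g {y ∷ ys} eq (there x∈ys) | _     , rest = ∑-mono-≤-tight f≤g rest x∈ys

χ : Bool → ℕ
χ true  = 1
χ false = 0

χ-T : ∀ {b} → T b → χ b ≡ 1
χ-T {true} _ = refl

χ-injective : ∀ {b c} → χ b ≡ χ c → b ≡ c
χ-injective {true}  {true}  _ = refl
χ-injective {false} {false} _ = refl

χ-mono : ∀ {b c} → (T b → T c) → χ b ≤ χ c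
χ-mono {true}  {true}  _   = ≤-refl
χ-mono {true}  {false} b⇒c = ⊥-elim (b⇒c _)
χ-mono {false}         _   = z≤n

χ-∧ : ∀ b c → χ (b ∧ c) ≡ χ b * χ c
χ-∧ true  true  = refl
χ-∧ true  false = refl
χ-∧ false _     = refl

χ-∨-∧ : ∀ b c → χ (b ∨ c) + χ (b ∧ c) ≡ χ b + χ c
χ-∨-∧ true  true  = refl
χ-∨-∧ true  false = refl
χ-∨-∧ false true  = refl
χ-∨-∧ false false = refl

χ-*-mono-≤ : ∀ b {m n} → (T b → m ≤ n) → χ b * m ≤ χ b * n
χ-*-mono-≤ true  m≤n = +-monoˡ-≤ 0 (m≤n _)
χ-*-mono-≤ false _   = z≤n

χ-*-≤ : ∀ b {m n} → (T b → m ≤ n) → χ b * m ≤ n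
χ-*-≤ true  {m} m≤n = ≤-trans (≤-reflexive (*-identityˡ m)) (m≤n _)
χ-*-≤ false _       = z≤n

χ-*-cancel : ∀ {b m n} → T b → χ b * m ≡ χ b * n → m ≡ n
χ-*-cancel {true} {m} {n} _ eq = trans (sym (*-identityˡ m)) (trans eq (*-identityˡ n))

χ-pairwise-∨ : ∀ b c d → T (b ∨ c) → T (b ∨ d) → T (c ∨ d) → 2 ≤ ∑ (b ∷ c ∷ d ∷ []) χ
χ-pairwise-∨ true  true  _     _ _ _ = s≤s (s≤s z≤n)
χ-pairwise-∨ true  false true  _ _ _ = s≤s (s≤s z≤n)
χ-pairwise-∨ false true  true  _ _ _ = s≤s (s≤s z≤n)

T-not⁺ : ∀ {b} → ¬ T b → T (not b)
T-not⁺ {true}  ¬b = ¬b _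
T-not⁺ {false} _  = _

T-not⁻ : ∀ {b} → T (not b) → ¬ T b
T-not⁻ {true} ()

count-⊆-tight : ∀ {p q : A → Bool} → (∀ x → T (p x) → T (q x)) →
                ∀ {xs} → ∑[ x ∈ xs ] χ (p x) ≡ ∑[ x ∈ xs ] χ (q x) →
                ∀ {x} → x ∈ xs → T (q x) → T (p x)
count-⊆-tight p⊆q eq x∈xs qx =
  subst T (sym (χ-injective (∑-mono-≤-tight (λ x → χ-mono (p⊆q x)) eq x∈xs))) qx

length-filterᵇ : ∀ (p : A → Bool) xs → length (filterᵇ p xs) ≡ ∑[ x ∈ xs ] χ (p x)
length-filterᵇ p []       = refl
length-filterᵇ p (x ∷ xs) with p x
... | true  = cong suc (length-filterᵇ p xs)
... | false = length-filterᵇ p xs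

length≡0⇒∉ : ∀ {xs : List A} {x} → length xs ≡ 0 → x ∉ xs
length≡0⇒∉ {xs = []} _ ()

∈⇒inListᵇ : ∀ {x : Fin n} {L} → x ∈ L → T (inListᵇ x L)
∈⇒inListᵇ x∈L = any⁺ _ (Any.map fromWitness x∈L)

inListᵇ⇒∈ : ∀ {x : Fin n} {L} → T (inListᵇ x L) → x ∈ L
inListᵇ⇒∈ {L = L} t = Any.map toWitness (any⁻ _ L t)

isXi : Graph n → List (Fin n) → ℕ → Fin n → Bool
isXi G K i x = not (inListᵇ x K) ∧ (nbrsIn G K x ≡ᵇ i)

module _ (G : Graph n) (K : List (Fin n)) where

  isXi⁺ : ∀ {i x} → x ∉ K → nbrsIn G K x ≡ i → T (isXi G K i x)
  isXi⁺ {i} {x} x∉K eq =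
    Equivalence.from T-∧ (T-not⁺ (x∉K ∘ inListᵇ⇒∈) , ≡⇒≡ᵇ (nbrsIn G K x) i eq)

  isXi⁻ : ∀ {i x} → T (isXi G K i x) → x ∉ K × nbrsIn G K x ≡ i
  isXi⁻ {i} {x} t with Equivalence.to T-∧ t
  ... | x∉K , eq = T-not⁻ x∉K ∘ ∈⇒inListᵇ , ≡ᵇ⇒≡ (nbrsIn G K x) i eq

  ∈-Xi⁺ : ∀ {i x} → T (isXi G K i x) → x ∈ Xi G K i
  ∈-Xi⁺ {i} {x} = ∈-filter⁺ (T? ∘ isXi G K i) (∈-allFin x)

  ∈-Xi⁻ : ∀ {i x} → x ∈ Xi G K i → T (isXi G K i x)
  ∈-Xi⁻ {i} x∈Xi = proj₂ (∈-filter⁻ (T? ∘ isXi G K i) {xs = V n} x∈Xi)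

  length-Xi : ∀ i → length (Xi G K i) ≡ ∑[ x ∈ V n ] χ (isXi G K i x)
  length-Xi i = length-filterᵇ (isXi G K i) (V n)

module _ (G : Graph n) where

  nbrsIn-∑ : ∀ L z → nbrsIn G L z ≡ ∑[ a ∈ L ] χ (adj G a z)
  nbrsIn-∑ L z = trans (length-filterᵇ (adj G z) L) (∑-cong (λ a → cong χ (adj-sym G z a)) L)

  nbrsIn≡0⇒¬adj : ∀ {L x y} → nbrsIn G L x ≡ 0 → y ∈ L → ¬ T (adj G x y)
  nbrsIn≡0⇒¬adj {x = x} eq y∈L xy = length≡0⇒∉ eq (∈-filter⁺ (T? ∘ adj G x) y∈L xy)

  nbrsIn≡length⇒adj : ∀ {L x y} → nbrsIn G L x ≡ length L → y ∈ L → T (adj G x y)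
  nbrsIn≡length⇒adj {L} {x} eq y∈L =
    proj₂ (∈-filter⁻ (T? ∘ adj G x) {xs = L}
      (subst (_ ∈_) (sym (filter-complete (T? ∘ adj G x) {xs = L} eq)) y∈L))

  clique-∷ : ∀ {L x} → IsClique G L → x ∉ L → nbrsIn G L x ≡ length L → IsClique G (x ∷ L)
  clique-∷ {L} {x} (L-unique , L-adj) x∉L x-adj-all =
    All.tabulate (λ y∈L x≡y → x∉L (subst (_∈ L) (sym x≡y) y∈L)) ∷ L-unique , adj′
    where
    adj′ : ∀ y z → y ∈ x ∷ L → z ∈ x ∷ L → ¬ y ≡ z → T (adj G y z)
    adj′ y z (here refl)  (here refl)  y≢z = ⊥-elim (y≢z refl)
    adj′ y z (here refl)  (there z∈L)  _   = nbrsIn≡length⇒adj x-adj-all z∈L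
    adj′ y z (there y∈L)  (here refl)  _   =
      subst T (adj-sym G z y) (nbrsIn≡length⇒adj x-adj-all y∈L)
    adj′ y z (there y∈L)  (there z∈L)  y≢z = L-adj y z y∈L z∈L y≢z

  ∑-nbrsIn≡∑-degree : ∀ L → ∑[ z ∈ V n ] nbrsIn G L z ≡ ∑[ a ∈ L ] degree G a
  ∑-nbrsIn≡∑-degree L = begin
    ∑[ z ∈ V n ] nbrsIn G L z                   ≡⟨ ∑-cong (nbrsIn-∑ L) (V n) ⟩
    ∑[ z ∈ V n ] ∑[ a ∈ L ] χ (adj G a z)       ≡⟨ ∑-swap _ (V n) L ⟩
    ∑[ a ∈ L ] ∑[ z ∈ V n ] χ (adj G a z)       ≡⟨ ∑-cong (λ a → sym (length-filterᵇ (adj G a) (V n))) L ⟩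
    ∑[ a ∈ L ] degree G a                       ∎
    where open ≡-Reasoning

  ∑-nbrs-nbrsIn≡∑-commonNbrs : ∀ a L →
    ∑[ z ∈ V n ] (χ (adj G a z) * nbrsIn G L z) ≡ ∑[ k ∈ L ] commonNbrs G a k
  ∑-nbrs-nbrsIn≡∑-commonNbrs a L = begin
    ∑[ z ∈ V n ] (χ (adj G a z) * nbrsIn G L z)
      ≡⟨ ∑-cong (λ z → cong (χ (adj G a z) *_) (nbrsIn-∑ L z)) (V n) ⟩
    ∑[ z ∈ V n ] (χ (adj G a z) * ∑[ k ∈ L ] χ (adj G k z))
      ≡⟨ ∑-cong (λ z → ∑-*ˡ (χ (adj G a z)) _ L) (V n) ⟨
    ∑[ z ∈ V n ] ∑[ k ∈ L ] (χ (adj G a z) * χ (adj G k z))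
      ≡⟨ ∑-swap _ (V n) L ⟩
    ∑[ k ∈ L ] ∑[ z ∈ V n ] (χ (adj G a z) * χ (adj G k z))
      ≡⟨ ∑-cong (λ k → ∑-cong (λ z → χ-∧ (adj G a z) (adj G k z)) (V n)) L ⟨
    ∑[ k ∈ L ] ∑[ z ∈ V n ] χ (adj G a z ∧ adj G k z)
      ≡⟨ ∑-cong (λ k → length-filterᵇ _ (V n)) L ⟨
    ∑[ k ∈ L ] commonNbrs G a k
      ∎
    where open ≡-Reasoning

  ∑-adj-∨+commonNbrs : ∀ a b →
    ∑[ z ∈ V n ] χ (adj G a z ∨ adj G b z) + commonNbrs G a b ≡ degree G a + degree G b
  ∑-adj-∨+commonNbrs a b = begin
    ∑[ z ∈ V n ] χ (a∼ z ∨ b∼ z) + commonNbrs G a b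
      ≡⟨ cong (∑[ z ∈ V n ] χ (a∼ z ∨ b∼ z) +_) (length-filterᵇ (λ z → a∼ z ∧ b∼ z) (V n)) ⟩
    ∑[ z ∈ V n ] χ (a∼ z ∨ b∼ z) + ∑[ z ∈ V n ] χ (a∼ z ∧ b∼ z)
      ≡⟨ ∑-+ _ _ (V n) ⟨
    ∑[ z ∈ V n ] (χ (a∼ z ∨ b∼ z) + χ (a∼ z ∧ b∼ z))
      ≡⟨ ∑-cong (λ z → χ-∨-∧ (a∼ z) (b∼ z)) (V n) ⟩
    ∑[ z ∈ V n ] (χ (a∼ z) + χ (b∼ z))
      ≡⟨ ∑-+ _ _ (V n) ⟩
    ∑[ z ∈ V n ] χ (a∼ z) + ∑[ z ∈ V n ] χ (b∼ z)
      ≡⟨ cong₂ _+_ (length-filterᵇ a∼ (V n)) (length-filterᵇ b∼ (V n)) ⟨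
    degree G a + degree G b
      ∎
    where
    open ≡-Reasoning
    a∼ b∼ : Fin n → Bool
    a∼ = adj G a
    b∼ = adj G b

module _ {v k l m} {G : Graph v} (srg : IsSRG v k l m G) where
  open IsSRG srg

  ∑-nbrsIn≡length*k : ∀ L → ∑[ z ∈ V v ] nbrsIn G L z ≡ length L * k
  ∑-nbrsIn≡length*k L = trans (∑-nbrsIn≡∑-degree G L) (∑-const L (λ {a} _ → regular a))

  ∑-nbrs-nbrsIn≡length*μ : ∀ a L → a ∉ L → nbrsIn G L a ≡ 0 →
    ∑[ z ∈ V v ] (χ (adj G a z) * nbrsIn G L z) ≡ length L * m
  ∑-nbrs-nbrsIn≡length*μ a L a∉L a-isolated =
    trans (∑-nbrs-nbrsIn≡∑-commonNbrs G a L) (∑-const L μ-from-a)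
    where
    μ-from-a : ∀ {b} → b ∈ L → commonNbrs G a b ≡ m
    μ-from-a {b} b∈L =
      mu a b (λ a≡b → a∉L (subst (_∈ L) (sym a≡b) b∈L)) (nbrsIn≡0⇒¬adj G a-isolated b∈L)

  ∑-adj-∨+μ : ∀ {a b} → ¬ a ≡ b → ¬ T (adj G a b) →
    ∑[ z ∈ V v ] χ (adj G a z ∨ adj G b z) + m ≡ k + k
  ∑-adj-∨+μ {a} {b} a≢b a≁b = begin
    ∑[ z ∈ V v ] χ (adj G a z ∨ adj G b z) + m            ≡⟨ cong (_ +_) (mu a b a≢b a≁b) ⟨
    ∑[ z ∈ V v ] χ (adj G a z ∨ adj G b z) + commonNbrs G a b ≡⟨ ∑-adj-∨+commonNbrs G a b ⟩
    degree G a + degree G b                                 ≡⟨ cong₂ _+_ (regular a) (regular b) ⟩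
    k + k                                                   ∎
    where open ≡-Reasoning

triple : ∀ (xs : List A) → length xs ≡ 3 → Σ A λ a → Σ A λ b → Σ A λ c → xs ≡ a ∷ b ∷ c ∷ []
triple (a ∷ b ∷ c ∷ []) refl = a , b , c , refl

module _ {X : Graph 95} (srg : IsSRG 95 40 12 20 X)
         {K : List (Fin 95)} (K-clique : IsKClique X 4 K)
         (K-maximal : ¬ (Σ (List (Fin 95)) λ L → IsKClique X 5 L × (K ⊆V L)))
         (|X₂|≡60 : length (Xi X K 2) ≡ 60) (|X₃|≡0 : length (Xi X K 3) ≡ 0) where
  open IsSRG srg

  |K|≡4 : length K ≡ 4
  |K|≡4 = proj₂ K-clique

  outside-K-≤2 : ∀ {z} → z ∉ K → nbrsIn X K z ≤ 2
  outside-K-≤2 {z} z∉K = s≤s⁻¹ (≤∧≢⇒< (s≤s⁻¹ (≤∧≢⇒< ≤4 ≢4)) ≢3)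
    where
    ≤4 : nbrsIn X K z ≤ 4
    ≤4 = subst (nbrsIn X K z ≤_) |K|≡4 (length-filter (T? ∘ adj X z) K)
    ≢4 : ¬ nbrsIn X K z ≡ 4
    ≢4 eq = K-maximal
      (z ∷ K , (clique-∷ X (proj₁ K-clique) z∉K (trans eq (sym |K|≡4)) , cong suc |K|≡4) , λ _ → there)
    ≢3 : ¬ nbrsIn X K z ≡ 3
    ≢3 eq = length≡0⇒∉ |X₃|≡0 (∈-Xi⁺ X K (isXi⁺ X K z∉K eq))

  X₀-nbr⇒X₂ : ∀ {a z} → T (isXi X K 0 a) → T (adj X a z) → T (isXi X K 2 z)
  X₀-nbr⇒X₂ {a} {z} a∈X₀ a∼z =
    isXi⁺ X K (nbr∉K a∼z) (χ-*-cancel a∼z (∑-mono-≤-tight bound total (∈-allFin z)))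
    where
    a∉K : a ∉ K
    a∉K = proj₁ (isXi⁻ X K a∈X₀)
    a-isolated : nbrsIn X K a ≡ 0
    a-isolated = proj₂ (isXi⁻ X K a∈X₀)
    nbr∉K : ∀ {y} → T (adj X a y) → y ∉ K
    nbr∉K a∼y y∈K = nbrsIn≡0⇒¬adj X a-isolated y∈K a∼y
    bound : ∀ y → χ (adj X a y) * nbrsIn X K y ≤ χ (adj X a y) * 2
    bound y = χ-*-mono-≤ (adj X a y) (outside-K-≤2 ∘ nbr∉K)
    total : ∑[ y ∈ V 95 ] (χ (adj X a y) * nbrsIn X K y) ≡ ∑[ y ∈ V 95 ] (χ (adj X a y) * 2)
    total = begin
      ∑[ y ∈ V 95 ] (χ (adj X a y) * nbrsIn X K y) ≡⟨ ∑-nbrs-nbrsIn≡length*μ srg a K a∉K a-isolated ⟩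
      length K * 20                                ≡⟨ cong (_* 20) |K|≡4 ⟩
      80                                           ≡⟨ cong (_* 2) (trans (sym (regular a)) (length-filterᵇ (adj X a) (V 95))) ⟩
      ∑[ y ∈ V 95 ] χ (adj X a y) * 2              ≡⟨ ∑-*ʳ 2 (χ ∘ adj X a) (V 95) ⟨
      ∑[ y ∈ V 95 ] (χ (adj X a y) * 2)            ∎
      where open ≡-Reasoning

  X₀-pair-covers-X₂ : ∀ {a b z} → T (isXi X K 0 a) → T (isXi X K 0 b) → ¬ a ≡ b →
                      T (isXi X K 2 z) → T (adj X a z ∨ adj X b z)
  X₀-pair-covers-X₂ {a} {b} {z} a∈X₀ b∈X₀ a≢b =
    -- p and q are given explicitly: inferring them would unfold the 95-term sums.
    count-⊆-tight {p = λ y → adj X a y ∨ adj X b y} {q = isXi X K 2} ∪⊆X₂ ∣∪∣≡∣X₂∣ (∈-allFin z)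
    where
    ∪⊆X₂ : ∀ y → T (adj X a y ∨ adj X b y) → T (isXi X K 2 y)
    ∪⊆X₂ y = [ X₀-nbr⇒X₂ a∈X₀ , X₀-nbr⇒X₂ b∈X₀ ] ∘ Equivalence.to T-∨
    a≁b : ¬ T (adj X a b)
    a≁b a∼b = 1+n≢0 (trans (sym (proj₂ (isXi⁻ X K (X₀-nbr⇒X₂ a∈X₀ a∼b))))
                           (proj₂ (isXi⁻ X K b∈X₀)))
    ∣∪∣≡∣X₂∣ : ∑[ y ∈ V 95 ] χ (adj X a y ∨ adj X b y) ≡ ∑[ y ∈ V 95 ] χ (isXi X K 2 y)
    ∣∪∣≡∣X₂∣ = +-cancelʳ-≡ 20 _ (∑[ y ∈ V 95 ] χ (isXi X K 2 y))
      (trans (∑-adj-∨+μ srg a≢b a≁b) (cong (_+ 20) (trans (sym |X₂|≡60) (length-Xi X K 2))))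

  X₂-nbrsIn-X₀-≥2 : ∀ {a b c} → Xi X K 0 ≡ a ∷ b ∷ c ∷ [] →
                     ∀ {z} → T (isXi X K 2 z) → 2 ≤ nbrsIn X (Xi X K 0) z
  X₂-nbrsIn-X₀-≥2 {a} {b} {c} X₀≡abc {z} z∈X₂ =
    subst (λ L → 2 ≤ nbrsIn X L z) (sym X₀≡abc)
      (subst (2 ≤_) (sym (nbrsIn-∑ X (a ∷ b ∷ c ∷ []) z))
        (sees-two (subst Unique X₀≡abc (filter⁺ (T? ∘ isXi X K 0) (allFin⁺ 95)))))
    where
    ∈X₀ : ∀ {y} → y ∈ a ∷ b ∷ c ∷ [] → T (isXi X K 0 y)
    ∈X₀ y∈abc = ∈-Xi⁻ X K (subst (_ ∈_) (sym X₀≡abc) y∈abc)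
    cover : ∀ {p q} → p ∈ a ∷ b ∷ c ∷ [] → q ∈ a ∷ b ∷ c ∷ [] → ¬ p ≡ q → T (adj X p z ∨ adj X q z)
    cover p∈abc q∈abc p≢q = X₀-pair-covers-X₂ (∈X₀ p∈abc) (∈X₀ q∈abc) p≢q z∈X₂
    sees-two : Unique (a ∷ b ∷ c ∷ []) → 2 ≤ ∑ (adj X a z ∷ adj X b z ∷ adj X c z ∷ []) χ
    sees-two ((a≢b All.∷ a≢c All.∷ All.[]) ∷ (b≢c All.∷ All.[]) ∷ All.[] ∷ []) =
      χ-pairwise-∨ (adj X a z) (adj X b z) (adj X c z)
        (cover (here refl) (there (here refl)) a≢b)
        (cover (here refl) (there (there (here refl))) a≢c)
        (cover (there (here refl)) (there (there (here refl))) b≢c)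

  X₂-nbrsIn-X₀ : ∀ {a b c} → Xi X K 0 ≡ a ∷ b ∷ c ∷ [] →
                 ∀ x → x ∈ Xi X K 2 → nbrsIn X (Xi X K 0) x ≡ 2
  X₂-nbrsIn-X₀ X₀≡abc x x∈X₂ =
    sym (trans (cong (_* 2) (sym (χ-T (∈-Xi⁻ X K x∈X₂)))) (∑-mono-≤-tight bound total (∈-allFin x)))
    where
    bound : ∀ z → χ (isXi X K 2 z) * 2 ≤ nbrsIn X (Xi X K 0) z
    bound z = χ-*-≤ (isXi X K 2 z) (X₂-nbrsIn-X₀-≥2 X₀≡abc)
    total : ∑[ z ∈ V 95 ] (χ (isXi X K 2 z) * 2) ≡ ∑[ z ∈ V 95 ] nbrsIn X (Xi X K 0) z
    total = begin
      ∑[ z ∈ V 95 ] (χ (isXi X K 2 z) * 2)  ≡⟨ ∑-*ʳ 2 (χ ∘ isXi X K 2) (V 95) ⟩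
      ∑[ z ∈ V 95 ] χ (isXi X K 2 z) * 2    ≡⟨ cong (_* 2) (trans (sym (length-Xi X K 2)) |X₂|≡60) ⟩
      120                                   ≡⟨ cong (λ L → length L * 40) X₀≡abc ⟨
      length (Xi X K 0) * 40                ≡⟨ ∑-nbrsIn≡length*k srg (Xi X K 0) ⟨
      ∑[ z ∈ V 95 ] nbrsIn X (Xi X K 0) z   ∎
      where open ≡-Reasoning

lemma1 : (X : Graph 95) → IsSRG 95 40 12 20 X
    → (K : List (Fin 95)) → IsKClique X 4 K
    → ¬ (Σ (List (Fin 95)) λ L → IsKClique X 5 L × (K ⊆V L))
    → length (Xi X K 0) ≡ 3 → length (Xi X K 1) ≡ 28
    → length (Xi X K 2) ≡ 60 → length (Xi X K 3) ≡ 0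
    → ∀ x → x ∈ Xi X K 2 → nbrsIn X (Xi X K 0) x ≡ 2
lemma1 X srg K K-clique K-maximal |X₀|≡3 _ |X₂|≡60 |X₃|≡0 =
  X₂-nbrsIn-X₀ srg K-clique K-maximal |X₂|≡60 |X₃|≡0
    (proj₂ (proj₂ (proj₂ (triple (Xi X K 0) |X₀|≡3))))
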